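{- We have $$T_2(\eta_1,\eta_3,\eta_4,k_1,\widetilde{X_5})= \psi(\eta_1,\eta_3,\eta_4) \sum_{\eta_2 \leq \widetilde{X_5}} \nu_{\eta_1,\eta_3,\eta_4}(\eta_2) \eta_2^{1/3}E(\boldsymbol{\eta},k_1,B),$$ where \begin{align*} \psi(\eta_1,\eta_3,\eta_4)& = \phi^*(\eta_1,\eta_3\eta_4) \prod_{\substack{p\mid \eta_1 \\ p \nmid \eta_3\eta_4 \\ p\neq2}} \left(1-\frac{2}{p}\right), \\ \widetilde{\nu}_{\eta_1,\eta_3,\eta_4}(\eta_2)& = \left\{ \begin{array}{ll} \phi^*(\eta_2) \prod_{\substack{p\mid \eta_1,\eta_2 \\ p \neq 2}} \left(1-\frac{2}{p}\right)^{ -1} ,&(\eta_2,\eta_3\eta_4)=1,\\ 0,& \mbox{otherwise}, \end{array} \right. \end{align*} and if $(\eta_1,\eta_3,\eta_4) \in \mathcal{N}_i$ ($i\in\{0,1\}$), then $$\nu_{\eta_1,\eta_3,\eta_4}(\eta_2)=\left\{ \begin{array}{ll} \widetilde{\nu}_{\eta_1,\eta_3,\eta_4}(\eta_2), &2^{i}\mid\eta_2,\\ 0,& \mbox{otherwise}. \end{array}\right.$$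
   Context: Let $B\geq 1$, let $\eta_1,\eta_3,\eta_4$ be positive integers with $(\eta_3,\eta_4)=1$, let $k_1$ be a positive integer, and write $\boldsymbol{\eta}=(\eta_1,\eta_2,\eta_3,\eta_4)$. Put $\widetilde{X_5}=\sqrt{B/(\eta_1^4\eta_3^3\eta_4^3)}$, and, as functions of $\eta_2$, $X_5=(\eta_1^4\eta_2^2\eta_3^3\eta_4^3/B)^{1/3}$ and $X_6=(\eta_1\eta_2^2/B)^{1/3}$. For $u,v\geq 0$, $(u,v)\neq(0,0)$, let $F_1(u,v)$ be the Lebesgue measure of $\{t\in\mathbb{R}: 0<|t(ut+v^2)|,|uvt|,|uvt+v^3|,|u^2t|,|u^2t+uv^2|\leq 1\}$, and with $\{\cdot\}$ the fractional part define $$E(\boldsymbol{\eta},k_1,B) =\int_0^{1}\left\{\frac{v}{k_1X_5^2X_6}\right\}\mathrm{d}F_1\left(X_5,\frac{v}{X_5^2}\right) -\left\{\frac{1}{k_1X_5^2X_6}\right\}F_1\left(X_5,\frac{1}{X_5^2}\right)$$ (a Stieltjes integral). Define $$T_2(\eta_1,\eta_3,\eta_4,k_1,\widetilde{X_5})=\sum_{\substack{\eta_2 \leq \widetilde{X_5} \\ (\eta_2,\eta_3\eta_4)=1}} \eta_2^{1/3}E(\boldsymbol{\eta},k_1,B) \sum_{\substack{k_3\mid\eta_1 \\ (k_3,\eta_2\eta_3)=1}}\frac{\mu(k_3)}{k_3} \sum_{\substack{k_2\mid\eta_1\eta_2 \\ (k_2,k_3\eta_4)=1}}\frac{\mu(k_2)}{k_2},$$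 with $\eta_2$ ranging over positive integers and $\mu$ the Möbius function. For positive integers $a_1,\ldots,a_n$ let $\phi^*(a_1,\ldots,a_n)=\prod_{p\mid(a_1,\ldots,a_n)}(1-1/p)$ (product over primes dividing the gcd), and $\phi^*(a)=\phi^*(a,a)=\prod_{p\mid a}(1-1/p)$. Let $\mathcal{N}_0 = \{(\eta_1,\eta_3,\eta_4) \in \mathbb{N}^3: 2\nmid\eta_1 \mbox{ or } 2 \mid \eta_3\eta_4\}$ and $\mathcal{N}_1 = \mathbb{N}^3 \setminus \mathcal{N}_0$. -}

module Defs where

open import Level using (Level)
open import Data.Nat as ℕ using (ℕ; zero; suc; _∸_; _≤_)
open import Data.Nat.Divisibility using (_∣_; _∣?_)
open import Data.Nat.GCD using (gcd)
open import Data.Nat.Coprimality using (Coprime; coprime?)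
open import Data.Nat.Primality using (Prime; prime?)
open import Data.Integer as ℤ using (ℤ; +_)
open import Data.Rational as ℚ using (ℚ; 0ℚ; 1ℚ; _-_; 1/_)
open import Data.Rational.Properties as ℚP using (_≟_)
open import Data.List using (List; []; _∷_; map; filter; upTo; length; foldr)
open import Data.List.Relation.Unary.Any using (any?)
open import Data.Product using (_×_)
open import Relation.Nullary using (yes; no; ¬_; ¬?)
open import Relation.Nullary.Decidable using (_×-dec_; does)
open import Data.Bool using (if_then_else_)
open import Algebra.Bundles using (CommutativeRing)

range1 : ℕ → List ℕ
range1 n = map suc (upTo n)

divisors : ℕ → List ℕ
divisors n = filter (λ d → d ∣? n) (range1 n)

primesOf : ℕ → List ℕ
primesOf n = filter (λ p → prime? p ×-dec (p ∣? n)) (range1 n)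

sumℚ : List ℚ → ℚ
sumℚ = foldr ℚ._+_ 0ℚ

prodℚ : List ℚ → ℚ
prodℚ = foldr ℚ._*_ 1ℚ

-- the rational number a/b  (with the convention a/0 = 0; only used with b ≥ 1)
frac : ℕ → ℕ → ℚ
frac a zero    = 0ℚ
frac a (suc b) = (+ a) ℚ./ (suc b)

-- multiplicative inverse in ℚ (convention 0⁻¹ = 0; only used on nonzero values)
invℚ : ℚ → ℚ
invℚ q with q ≟ 0ℚ
... | yes _  = 0ℚ
... | no q≢0 = 1/_ q {{ℚ.≢-nonZero q≢0}}

μ : ℕ → ℚ
μ n = if does (any? (λ p → (p ℕ.* p) ∣? n) (primesOf n))
        then 0ℚ
        else prodℚ (map (λ _ → ℚ.- 1ℚ) (primesOf n))

φ* : ℕ → ℚ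
φ* a = prodℚ (map (λ p → 1ℚ - frac 1 p) (primesOf a))

φ*₂ : ℕ → ℕ → ℚ
φ*₂ a b = φ* (gcd a b)

ψ : ℕ → ℕ → ℕ → ℚ
ψ η₁ η₃ η₄ =
  φ*₂ η₁ (η₃ ℕ.* η₄) ℚ.*
  prodℚ (map (λ p → 1ℚ - frac 2 p)
    (filter (λ p → ¬? (p ∣? (η₃ ℕ.* η₄)) ×-dec ¬? (p ℕ.≟ 2)) (primesOf η₁)))

νtilde : ℕ → ℕ → ℕ → ℕ → ℚ
νtilde η₁ η₃ η₄ η₂ with coprime? η₂ (η₃ ℕ.* η₄)
... | yes _ = φ* η₂ ℚ.*
              prodℚ (map (λ p → invℚ (1ℚ - frac 2 p))
                (filter (λ p → ¬? (p ℕ.≟ 2)) (primesOf (gcd η₁ η₂))))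
... | no _  = 0ℚ

-- index i with (η₁,η₃,η₄) ∈ 𝒩_i :  𝒩₀ = {2 ∤ η₁ or 2 ∣ η₃η₄},  𝒩₁ = complement
indexN : ℕ → ℕ → ℕ → ℕ
indexN η₁ η₃ η₄ with 2 ∣? η₁ | 2 ∣? (η₃ ℕ.* η₄)
... | no _  | _     = 0
... | yes _ | yes _ = 0
... | yes _ | no _  = 1

ν : ℕ → ℕ → ℕ → ℕ → ℚ
ν η₁ η₃ η₄ η₂ with (2 ℕ.^ indexN η₁ η₃ η₄) ∣? η₂
... | yes _ = νtilde η₁ η₃ η₄ η₂
... | no _  = 0ℚ

innerWeight : ℕ → ℕ → ℕ → ℕ → ℚ
innerWeight η₁ η₂ η₃ η₄ =
  sumℚ (map (λ k₃ → (μ k₃ ℚ.* frac 1 k₃) ℚ.*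
              sumℚ (map (λ k₂ → μ k₂ ℚ.* frac 1 k₂)
                (filter (λ k₂ → coprime? k₂ (k₃ ℕ.* η₄)) (divisors (η₁ ℕ.* η₂)))))
    (filter (λ k₃ → coprime? k₃ (η₂ ℕ.* η₃)) (divisors η₁)))

module _ {c ℓ : Level} (R : CommutativeRing c ℓ) where
  open CommutativeRing R

  sumR : List Carrier → Carrier
  sumR = foldr _+_ 0#

open import Algebra.Morphism.Structures using (IsRingHomomorphism)

IsℚAlgebraMap : {c ℓ : Level} (R : CommutativeRing c ℓ) → (ℚ → CommutativeRing.Carrier R) → Set _
IsℚAlgebraMap R ι = IsRingHomomorphism (CommutativeRing.rawRing ℚP.+-*-commutativeRing) (CommutativeRing.rawRing R) ι

-- T₂ with the analytic factor η₂^{1/3} E(η,k₁,B) abstracted as w(η₂) ∈ R, and η₂ ≤ X̃₅ as η₂ ≤ N (N = ⌊X̃₅⌋)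
T₂ : {c ℓ : Level} (R : CommutativeRing c ℓ) (ι : ℚ → CommutativeRing.Carrier R)
     (η₁ η₃ η₄ N : ℕ) (w : ℕ → CommutativeRing.Carrier R) → CommutativeRing.Carrier R
T₂ R ι η₁ η₃ η₄ N w =
  sumR R (map (λ η₂ → w η₂ * ι (innerWeight η₁ η₂ η₃ η₄))
               (filter (λ η₂ → coprime? η₂ (η₃ ℕ.* η₄)) (range1 N)))
  where open CommutativeRing R

T₂rhs : {c ℓ : Level} (R : CommutativeRing c ℓ) (ι : ℚ → CommutativeRing.Carrier R)
        (η₁ η₃ η₄ N : ℕ) (w : ℕ → CommutativeRing.Carrier R) → CommutativeRing.Carrier R
T₂rhs R ι η₁ η₃ η₄ N w =
  ι (ψ η₁ η₃ η₄) * sumR R (map (λ η₂ → ι (ν η₁ η₃ η₄ η₂) * w η₂) (range1 N))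
  where open CommutativeRing R

-- Everything is an Euler product. For multiplicative h one has ∑_{d ∣ n} μ(d) h(d) = ∏_{p ∣ n} (1 - h(p)),
-- so the sum over k₂ equals ∏_{p ∣ η₁η₂, p ∤ k₃η₄} (1 - 1/p), and the remaining sum over k₃ ∣ η₁ is again
-- of this shape, with h(k₃) = [k₃ ⊥ η₂η₃] k₃⁻¹ ∏_{p ∣ k₃} (1 - [p ∤ η₄]/p)⁻¹. The weight of η₂ thus becomes
-- a product of local factors, which is compared with ψ ν̃ prime by prime. The coprimality of η₂ with η₃η₄ and
-- of η₃ with η₄ leaves few cases, and they agree except at p = 2 when 2 ∣ η₁ and 2 ∤ η₂η₃η₄: there the local
-- factor (1 - 1/2)(1 - (1/2)(1 - 1/2)⁻¹) of the weight vanishes, which is what the condition 2ⁱ ∣ η₂ in ν records.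
module Submission where

open import Defs
open import Level using (Level; 0ℓ)
open import Data.Nat as ℕ using (ℕ; zero; suc; _≤_; _<_; z≤n; s≤s)
import Data.Nat.Properties as ℕP
open import Data.Nat.Induction using (<-rec)
open import Induction.WellFounded using (WfRec)
open import Data.Nat.Divisibility
  using (_∣_; _∣?_; divides; ∣-trans; ∣⇒≤; ∣-refl; m∣m*n; ∣m⇒∣m*n; ∣n⇒∣m*n; *-cancelˡ-∣; *-monoʳ-∣;
         *-pres-∣; ∣m+n∣m⇒∣n; ∣1⇒≡1; 0∣⇒≡0; 1∣_)
open import Data.Nat.GCD using (gcd; gcd[m,n]∣m; gcd[m,n]∣n; gcd-greatest)
open import Data.Nat.Coprimality as Coprimality using (Coprime; coprime?; coprime-divisor)
open import Data.Nat.Primality using (Prime; prime?; prime[2]; euclidsLemma; prime⇒irreducible; prime⇒nonTrivial)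
open import Data.Nat.Primality.Factorisation using (factorise)
import Data.Nat.ListAction as ℕL
open import Data.Integer as ℤ using (+_)
import Data.Integer.Properties as ℤP
import Data.Integer.Solver as ℤSolver
open import Data.Rational as ℚ using (ℚ; 0ℚ; 1ℚ; _-_; _*_; _+_; -_; toℚᵘ)
open import Data.Rational.Unnormalised as ℚᵘ using (mkℚᵘ) renaming (_≃_ to _≃ᵘ_)
import Data.Rational.Unnormalised.Properties as ℚᵘP
import Data.Rational.Properties as ℚP
open import Data.Rational.Solver using (module +-*-Solver)
open +-*-Solver using (solve; _:=_; _:+_; _:*_; _:-_; :-_; con)
open import Data.List using (List; []; _∷_; map; filter; upTo; foldr; _++_; [_])
import Data.List.Properties as ListP
open import Data.List.Membership.Propositional using (_∈_; find; lose)
import Data.List.Membership.Propositional.Properties as ∈P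
open import Data.List.Relation.Unary.All using (_∷_)
open import Data.List.Relation.Unary.Any as Any using (Any; any?)
open import Data.Bool using (Bool; true; false; if_then_else_; _∧_; _∨_; not)
open import Data.Product using (_×_; _,_; proj₁; proj₂; ∃)
open import Data.Sum using (inj₁; inj₂; [_,_]′)
open import Data.Empty using (⊥-elim)
open import Function using (_∘_)
open import Relation.Nullary using (Dec; yes; no; ¬_; does)
open import Relation.Nullary.Decidable using (dec-true; dec-false; _×-dec_; ¬?)
open import Relation.Unary using (Pred; Decidable)
open import Relation.Binary.PropositionalEquality
  using (_≡_; _≢_; refl; sym; trans; cong; cong₂; subst; module ≡-Reasoning)
import Relation.Binary.Reasoning.Setoid as SetoidReasoning
open import Algebra.Core using (Op₂)
open import Algebra.Structures using (IsCommutativeMonoid)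
open import Algebra.Bundles using (CommutativeRing; CommutativeSemigroup)
open import Algebra.Morphism.Structures using (IsRingHomomorphism)

toℚᵘ-frac : ∀ a n → toℚᵘ (frac a (suc n)) ≃ᵘ mkℚᵘ (+ a) n
toℚᵘ-frac a n = ℚP.toℚᵘ-fromℚᵘ (mkℚᵘ (+ a) n)

frac-1-* : ∀ m n → frac 1 (m ℕ.* n) ≡ frac 1 m * frac 1 n
frac-1-* zero    n       = sym (ℚP.*-zeroˡ (frac 1 n))
frac-1-* (suc m) zero    rewrite ℕP.*-zeroʳ m = sym (ℚP.*-zeroʳ (frac 1 (suc m)))
frac-1-* (suc m) (suc n) = ℚP.toℚᵘ-injective (begin
  toℚᵘ (frac 1 (suc m ℕ.* suc n))                   ≈⟨ toℚᵘ-frac 1 _ ⟩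
  mkℚᵘ (+ 1) m ℚᵘ.* mkℚᵘ (+ 1) n                    ≈⟨ ℚᵘP.*-cong (toℚᵘ-frac 1 m) (toℚᵘ-frac 1 n) ⟨
  toℚᵘ (frac 1 (suc m)) ℚᵘ.* toℚᵘ (frac 1 (suc n))  ≈⟨ ℚP.toℚᵘ-homo-* (frac 1 (suc m)) (frac 1 (suc n)) ⟨
  toℚᵘ (frac 1 (suc m) * frac 1 (suc n))            ∎)
  where open SetoidReasoning ℚᵘP.≃-setoid

frac-2 : ∀ n → frac 2 n ≡ frac 1 n + frac 1 n
frac-2 zero    = refl
frac-2 (suc n) = ℚP.toℚᵘ-injective (begin
  toℚᵘ (frac 2 (suc n))                             ≈⟨ toℚᵘ-frac 2 n ⟩
  mkℚᵘ (+ 2) n                                      ≈⟨ ℚᵘ.*≡* cross ⟩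
  mkℚᵘ (+ 1) n ℚᵘ.+ mkℚᵘ (+ 1) n                    ≈⟨ ℚᵘP.+-cong (toℚᵘ-frac 1 n) (toℚᵘ-frac 1 n) ⟨
  toℚᵘ (frac 1 (suc n)) ℚᵘ.+ toℚᵘ (frac 1 (suc n))  ≈⟨ ℚP.toℚᵘ-homo-+ (frac 1 (suc n)) (frac 1 (suc n)) ⟨
  toℚᵘ (frac 1 (suc n) + frac 1 (suc n))            ∎)
  where
  open SetoidReasoning ℚᵘP.≃-setoid
  open ℤSolver.+-*-Solver using () renaming (solve to solveℤ; _:=_ to _:=ℤ_; _:*_ to _:*ℤ_; _:+_ to _:+ℤ_; con to conℤ)
  cross : (+ 2) ℤ.* ℚᵘ.↧ (mkℚᵘ (+ 1) n ℚᵘ.+ mkℚᵘ (+ 1) n) ≡ ℚᵘ.↥ (mkℚᵘ (+ 1) n ℚᵘ.+ mkℚᵘ (+ 1) n) ℤ.* (+ suc n)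
  cross = solveℤ 1 (λ x → conℤ (+ 2) :*ℤ (x :*ℤ x) :=ℤ (conℤ (+ 1) :*ℤ x :+ℤ conℤ (+ 1) :*ℤ x) :*ℤ x) refl (+ suc n)

frac≡1⇒≡ : ∀ a n → frac a (suc n) ≡ 1ℚ → a ≡ suc n
frac≡1⇒≡ a n eq with ℚᵘP.≃-trans (ℚᵘP.≃-sym (toℚᵘ-frac a n)) (ℚP.toℚᵘ-cong eq)
... | ℚᵘ.*≡* cross = ℤP.+-injective (trans (sym (ℤP.*-identityʳ (+ a))) (trans cross (ℤP.*-identityˡ _)))

1-frac≢0 : ∀ a n → 1 ≤ n → a ≢ n → 1ℚ - frac a n ≢ 0ℚ
1-frac≢0 a (suc n) _ a≢1+n eq = a≢1+n (frac≡1⇒≡ a n (trans (x≡1-[1-x] _) (cong (λ t → 1ℚ - t) eq)))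
  where
  x≡1-[1-x] : ∀ x → x ≡ 1ℚ - (1ℚ - x)
  x≡1-[1-x] = solve 1 (λ x → x := con 1ℚ :- (con 1ℚ :- x)) refl

*-invℚ : ∀ x → x ≢ 0ℚ → x * invℚ x ≡ 1ℚ
*-invℚ x x≢0 with x ℚP.≟ 0ℚ
... | yes x≡0 = ⊥-elim (x≢0 x≡0)
... | no  x≢0 = ℚP.*-inverseʳ x {{ℚ.≢-nonZero x≢0}}

range1-suc : ∀ n → range1 (suc n) ≡ range1 n ++ [ suc n ]
range1-suc n = trans (cong (map suc) (sym (ListP.upTo-∷ʳ n))) (ListP.map-++ suc (upTo n) [ n ])

module BigOperator {A : Set} {_∙_ : Op₂ A} {ε : A} (isCM : IsCommutativeMonoid _≡_ _∙_ ε) where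
  open IsCommutativeMonoid isCM using (assoc; identityˡ; identityʳ; isCommutativeSemigroup)

  commutativeSemigroup : CommutativeSemigroup 0ℓ 0ℓ
  commutativeSemigroup = record { isCommutativeSemigroup = isCommutativeSemigroup }

  open import Algebra.Properties.CommutativeSemigroup commutativeSemigroup using (interchange)

  big : ℕ → (ℕ → A) → A
  big zero    F = ε
  big (suc n) F = big n F ∙ F (suc n)

  fold : List A → A
  fold = foldr _∙_ ε

  fold-++ : ∀ xs ys → fold (xs ++ ys) ≡ fold xs ∙ fold ys
  fold-++ []       ys = sym (identityˡ _)
  fold-++ (x ∷ xs) ys = trans (cong (x ∙_) (fold-++ xs ys)) (sym (assoc x _ _))

  fold-range1 : ∀ (F : ℕ → A) n → fold (map F (range1 n)) ≡ big n F
  fold-range1 F zero    = refl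
  fold-range1 F (suc n) = begin
    fold (map F (range1 (suc n)))             ≡⟨ cong (fold ∘ map F) (range1-suc n) ⟩
    fold (map F (range1 n ++ [ suc n ]))      ≡⟨ cong fold (ListP.map-++ F (range1 n) [ suc n ]) ⟩
    fold (map F (range1 n) ++ [ F (suc n) ])  ≡⟨ fold-++ (map F (range1 n)) _ ⟩
    fold (map F (range1 n)) ∙ (F (suc n) ∙ ε) ≡⟨ cong₂ _∙_ (fold-range1 F n) (identityʳ _) ⟩
    big n F ∙ F (suc n)                       ∎
    where open ≡-Reasoning

  fold-filter : ∀ {B : Set} {P : Pred B 0ℓ} (P? : Decidable P) (F : B → A) xs →
    fold (map F (filter P? xs)) ≡ fold (map (λ x → if does (P? x) then F x else ε) xs)
  fold-filter P? F []       = refl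
  fold-filter P? F (x ∷ xs) with does (P? x)
  ... | true  = cong (F x ∙_) (fold-filter P? F xs)
  ... | false = trans (fold-filter P? F xs) (sym (identityˡ _))

  big-cong : ∀ n {F G : ℕ → A} → (∀ k → 1 ≤ k → k ≤ n → F k ≡ G k) → big n F ≡ big n G
  big-cong zero    F≡G = refl
  big-cong (suc n) F≡G =
    cong₂ _∙_ (big-cong n (λ k 1≤k k≤n → F≡G k 1≤k (ℕP.m≤n⇒m≤1+n k≤n))) (F≡G (suc n) (s≤s z≤n) ℕP.≤-refl)

  big-∙ : ∀ n (F G : ℕ → A) → big n (λ k → F k ∙ G k) ≡ big n F ∙ big n G
  big-∙ zero    F G = sym (identityˡ ε)
  big-∙ (suc n) F G = trans (cong (_∙ (F (suc n) ∙ G (suc n))) (big-∙ n F G)) (interchange _ _ _ _)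

  big-ε : ∀ n {F : ℕ → A} → (∀ k → 1 ≤ k → k ≤ n → F k ≡ ε) → big n F ≡ ε
  big-ε n F≡ε = trans (big-cong n F≡ε) (big-const-ε n)
    where
    big-const-ε : ∀ n → big n (λ _ → ε) ≡ ε
    big-const-ε zero    = refl
    big-const-ε (suc n) = trans (identityʳ _) (big-const-ε n)

  big-extend : ∀ m n {F : ℕ → A} → m ≤ n → (∀ k → m < k → k ≤ n → F k ≡ ε) → big n F ≡ big m F
  big-extend m zero    z≤n  _    = refl
  big-extend m (suc n) m≤1+n F≡ε with m ℕP.≟ suc n
  ... | yes refl = refl
  ... | no  m≢1+n = trans
    (cong₂ _∙_ (big-extend m n m≤n (λ k m<k k≤n → F≡ε k m<k (ℕP.m≤n⇒m≤1+n k≤n))) (F≡ε (suc n) (s≤s m≤n) ℕP.≤-refl))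
    (identityʳ _)
    where m≤n = ℕP.≤-pred (ℕP.≤∧≢⇒< m≤1+n m≢1+n)

  big-+ : ∀ a b (F : ℕ → A) → big (a ℕ.+ b) F ≡ big a F ∙ big b (λ j → F (a ℕ.+ j))
  big-+ a zero    F = trans (cong (λ t → big t F) (ℕP.+-identityʳ a)) (sym (identityʳ _))
  big-+ a (suc b) F = begin
    big (a ℕ.+ suc b) F                                      ≡⟨ cong (λ t → big t F) (ℕP.+-suc a b) ⟩
    big (a ℕ.+ b) F ∙ F (suc (a ℕ.+ b))                      ≡⟨ cong₂ _∙_ (big-+ a b F) (cong F (sym (ℕP.+-suc a b))) ⟩
    (big a F ∙ big b (λ j → F (a ℕ.+ j))) ∙ F (a ℕ.+ suc b) ≡⟨ assoc _ _ _ ⟩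
    big a F ∙ big (suc b) (λ j → F (a ℕ.+ j))                ∎
    where open ≡-Reasoning

  big-single : ∀ n p {F : ℕ → A} → 1 ≤ p → p ≤ n → (∀ k → 1 ≤ k → k ≤ n → k ≢ p → F k ≡ ε) → big n F ≡ F p
  big-single zero    zero () z≤n _
  big-single (suc n) p {F} 1≤p p≤1+n F≡ε with p ℕP.≟ suc n
  ... | yes refl = trans
    (cong (_∙ F (suc n)) (big-ε n (λ k 1≤k k≤n → F≡ε k 1≤k (ℕP.m≤n⇒m≤1+n k≤n) (ℕP.<⇒≢ (s≤s k≤n)))))
    (identityˡ _)
  ... | no p≢1+n = trans
    (cong₂ _∙_ (big-single n p 1≤p (ℕP.≤-pred (ℕP.≤∧≢⇒< p≤1+n p≢1+n)) (λ k 1≤k k≤n → F≡ε k 1≤k (ℕP.m≤n⇒m≤1+n k≤n)))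
               (F≡ε (suc n) (s≤s z≤n) ℕP.≤-refl (p≢1+n ∘ sym)))
    (identityʳ _)

  big-partition : ∀ n (A? : ℕ → Bool) (F : ℕ → A) →
    big n F ≡ big n (λ k → if A? k then F k else ε) ∙ big n (λ k → if A? k then ε else F k)
  big-partition n A? F = trans (big-cong n (λ k _ _ → split k)) (big-∙ n _ _)
    where
    split : ∀ k → F k ≡ (if A? k then F k else ε) ∙ (if A? k then ε else F k)
    split k with A? k
    ... | true  = sym (identityʳ _)
    ... | false = sym (identityˡ _)

module ∑ = BigOperator ℚP.+-0-isCommutativeMonoid
module ∏ = BigOperator ℚP.*-1-isCommutativeMonoid

∑-*-distribˡ : ∀ n c F → c * ∑.big n F ≡ ∑.big n (λ k → c * F k)
∑-*-distribˡ zero    c F = ℚP.*-zeroʳ c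
∑-*-distribˡ (suc n) c F = trans (ℚP.*-distribˡ-+ c _ _) (cong (_+ c * F (suc n)) (∑-*-distribˡ n c F))

∏-zero : ∀ n k F → 1 ≤ k → k ≤ n → F k ≡ 0ℚ → ∏.big n F ≡ 0ℚ
∏-zero zero    zero F () z≤n _
∏-zero (suc n) k F 1≤k k≤1+n Fk≡0 with k ℕP.≟ suc n
... | yes refl  = trans (cong (∏.big n F *_) Fk≡0) (ℚP.*-zeroʳ (∏.big n F))
... | no k≢1+n = trans (cong (_* F (suc n)) (∏-zero n k F 1≤k (ℕP.≤-pred (ℕP.≤∧≢⇒< k≤1+n k≢1+n)) Fk≡0)) (ℚP.*-zeroˡ (F (suc n)))

prime⇒2≤ : ∀ {p} → Prime p → 2 ≤ p
prime⇒2≤ {p} pp = ℕ.nonTrivial⇒n>1 p {{prime⇒nonTrivial pp}}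

prime⇒1≤ : ∀ {p} → Prime p → 1 ≤ p
prime⇒1≤ pp = ℕP.≤-trans (s≤s z≤n) (prime⇒2≤ pp)

prime⇒≢1 : ∀ {p} → Prime p → p ≢ 1
prime⇒≢1 pp refl = ℕP.<-irrefl refl (prime⇒2≤ pp)

prime∤1 : ∀ {p} → Prime p → ¬ p ∣ 1
prime∤1 pp = prime⇒≢1 pp ∘ ∣1⇒≡1

prime∣prime⇒≡ : ∀ {q p} → Prime q → Prime p → q ∣ p → q ≡ p
prime∣prime⇒≡ pq pp q∣p with prime⇒irreducible pp q∣p
... | inj₁ refl = ⊥-elim (prime⇒≢1 pq refl)
... | inj₂ q≡p  = q≡p

prime∤⇒coprime : ∀ {p m} → Prime p → ¬ p ∣ m → Coprime p m
prime∤⇒coprime pp p∤m (d∣p , d∣m) with prime⇒irreducible pp d∣p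
... | inj₁ d≡1 = d≡1
... | inj₂ refl = ⊥-elim (p∤m d∣m)

coprime⇒prime∤ : ∀ {p m} → Prime p → Coprime p m → ¬ p ∣ m
coprime⇒prime∤ pp p⊥m p∣m = prime⇒≢1 pp (p⊥m (∣-refl , p∣m))

coprime-1 : ∀ m → Coprime 1 m
coprime-1 m (d∣1 , _) = ∣1⇒≡1 d∣1

coprime-* : ∀ {a b m} → Coprime a m → Coprime b m → Coprime (a ℕ.* b) m
coprime-* {a} {b} a⊥m b⊥m {d} (d∣ab , d∣m) = a⊥m (coprime-divisor d⊥b (subst (d ∣_) (ℕP.*-comm a b) d∣ab) , d∣m)
  where
  d⊥b : Coprime d b
  d⊥b (i∣d , i∣b) = b⊥m (i∣b , ∣-trans i∣d d∣m)

coprime-*ˡ : ∀ {a b m} → Coprime (a ℕ.* b) m → Coprime a m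
coprime-*ˡ {b = b} ab⊥m (i∣a , i∣m) = ab⊥m (∣m⇒∣m*n b i∣a , i∣m)

coprime-*ʳ : ∀ {a b m} → Coprime (a ℕ.* b) m → Coprime b m
coprime-*ʳ {a} ab⊥m (i∣b , i∣m) = ab⊥m (∣n⇒∣m*n a i∣b , i∣m)

∣⇒1≤ : ∀ {n d} → 1 ≤ n → d ∣ n → 1 ≤ d
∣⇒1≤ {suc n} {zero}  _ d∣n with () ← 0∣⇒≡0 d∣n
∣⇒1≤ {suc n} {suc d} _ _   = s≤s z≤n

>⇒∤ : ∀ {n k} → 1 ≤ n → n < k → ¬ k ∣ n
>⇒∤ {suc n} _ n<k k∣n = ℕP.<⇒≱ n<k (∣⇒≤ k∣n)

1≤gcd : ∀ a m → 1 ≤ a → 1 ≤ gcd a m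
1≤gcd a m 1≤a = ∣⇒1≤ 1≤a (gcd[m,n]∣m a m)

∃prime∣ : ∀ n → 2 ≤ n → ∃ λ p → Prime p × p ∣ n
∃prime∣ (suc zero) (s≤s ())
∃prime∣ n@(suc (suc _)) _ with factorise n
... | record { factors = [] ; isFactorisation = () }
... | record { factors = p ∷ ps ; isFactorisation = n≡p*ps ; factorsPrime = pp ∷ _ } =
  p , pp , divides (ℕL.product ps) (trans n≡p*ps (ℕP.*-comm p _))

does-⇔ : ∀ {A B : Set} (a : Dec A) (b : Dec B) → (A → B) → (B → A) → does a ≡ does b
does-⇔ (yes a) (yes b) _ _ = refl
does-⇔ (no ¬a) (no ¬b) _ _ = refl
does-⇔ (yes a) (no ¬b) f _ = ⊥-elim (¬b (f a))
does-⇔ (no ¬a) (yes b) _ g = ⊥-elim (¬a (g b))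

∣?-* : ∀ q m n → Prime q → does (q ∣? (m ℕ.* n)) ≡ does (q ∣? m) ∨ does (q ∣? n)
∣?-* q m n pq with q ∣? m | q ∣? n
... | yes q∣m | _      = dec-true (q ∣? _) (∣m⇒∣m*n n q∣m)
... | no _    | yes q∣n = dec-true (q ∣? _) (∣n⇒∣m*n m q∣n)
... | no q∤m  | no q∤n = dec-false (q ∣? _) ([ q∤m , q∤n ]′ ∘ euclidsLemma m n pq)

∣?-gcd : ∀ q m n → does (q ∣? gcd m n) ≡ does (q ∣? m) ∧ does (q ∣? n)
∣?-gcd q m n with q ∣? m | q ∣? n
... | yes q∣m | yes q∣n = dec-true (q ∣? _) (gcd-greatest q∣m q∣n)
... | no q∤m  | _       = dec-false (q ∣? _) (λ q∣g → q∤m (∣-trans q∣g (gcd[m,n]∣m m n)))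
... | yes _   | no q∤n  = dec-false (q ∣? _) (λ q∣g → q∤n (∣-trans q∣g (gcd[m,n]∣n m n)))

coprime?-prime : ∀ q m → Prime q → does (coprime? q m) ≡ not (does (q ∣? m))
coprime?-prime q m pq with q ∣? m
... | yes q∣m = dec-false (coprime? q m) (λ q⊥m → coprime⇒prime∤ pq q⊥m q∣m)
... | no q∤m  = dec-true (coprime? q m) (prime∤⇒coprime pq q∤m)

-- Products over prime divisors and sums over divisors

onPrimeDivisors : ℕ → (ℕ → ℚ) → ℕ → ℚ
onPrimeDivisors n g q = if does (prime? q) then (if does (q ∣? n) then g q else 1ℚ) else 1ℚ

-- Running over all q ≤ M rather than over the primes of n makes products for different n
-- comparable factor by factor.
primeProduct : ℕ → ℕ → (ℕ → ℚ) → ℚ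
primeProduct M n g = ∏.big M (onPrimeDivisors n g)

onDivisors : ℕ → (ℕ → ℚ) → ℕ → ℚ
onDivisors n F d = if does (d ∣? n) then F d else 0ℚ

divisorSum : ℕ → (ℕ → ℚ) → ℚ
divisorSum n F = ∑.big n (onDivisors n F)

prodℚ-primesOf : ∀ n M (g : ℕ → ℚ) → 1 ≤ n → n ≤ M → prodℚ (map g (primesOf n)) ≡ primeProduct M n g
prodℚ-primesOf n M g 1≤n n≤M = begin
  prodℚ (map g (primesOf n))   ≡⟨ ∏.fold-filter (λ p → prime? p ×-dec (p ∣? n)) g (range1 n) ⟩
  ∏.fold (map _ (range1 n))    ≡⟨ ∏.fold-range1 _ n ⟩
  ∏.big n _                    ≡⟨ ∏.big-cong n (λ q _ _ → reorder q) ⟩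
  ∏.big n (onPrimeDivisors n g) ≡⟨ ∏.big-extend n M n≤M (λ q n<q _ → beyond q n<q) ⟨
  primeProduct M n g           ∎
  where
  open ≡-Reasoning
  reorder : ∀ q → (if does (prime? q ×-dec (q ∣? n)) then g q else 1ℚ) ≡ onPrimeDivisors n g q
  reorder q with prime? q
  ... | yes _ = refl
  ... | no _  = refl
  beyond : ∀ q → n < q → onPrimeDivisors n g q ≡ 1ℚ
  beyond q n<q rewrite dec-false (q ∣? n) (>⇒∤ 1≤n n<q) with prime? q
  ... | yes _ = refl
  ... | no _  = refl

sumℚ-divisors : ∀ n (F : ℕ → ℚ) → sumℚ (map F (divisors n)) ≡ divisorSum n F
sumℚ-divisors n F = trans (∑.fold-filter (λ d → d ∣? n) F (range1 n)) (∑.fold-range1 _ n)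

primeProduct-cong : ∀ M n {g g′ : ℕ → ℚ} → (∀ q → g q ≡ g′ q) → primeProduct M n g ≡ primeProduct M n g′
primeProduct-cong M n g≡g′ = ∏.big-cong M (λ q _ _ → cong (λ t → if does (prime? q) then (if does (q ∣? n) then t else 1ℚ) else 1ℚ) (g≡g′ q))

primeProduct-radical : ∀ M m n (g : ℕ → ℚ) → (∀ q → Prime q → q ∣ m → q ∣ n) → (∀ q → Prime q → q ∣ n → q ∣ m) →
  primeProduct M m g ≡ primeProduct M n g
primeProduct-radical M m n g m→n n→m = ∏.big-cong M (λ q _ _ → same q)
  where
  same : ∀ q → onPrimeDivisors m g q ≡ onPrimeDivisors n g q
  same q with prime? q
  ... | no _   = refl
  ... | yes pq = cong (λ b → if b then g q else 1ℚ) (does-⇔ (q ∣? m) (q ∣? n) (m→n q pq) (n→m q pq))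

primeProduct-1 : ∀ M g → primeProduct M 1 g ≡ 1ℚ
primeProduct-1 M g = ∏.big-ε M (λ q _ _ → trivial q)
  where
  trivial : ∀ q → onPrimeDivisors 1 g q ≡ 1ℚ
  trivial q with prime? q
  ... | no _   = refl
  ... | yes pq rewrite dec-false (q ∣? 1) (prime∤1 pq) = refl

primeProduct-* : ∀ M m n (g : ℕ → ℚ) → Coprime m n → primeProduct M (m ℕ.* n) g ≡ primeProduct M m g * primeProduct M n g
primeProduct-* M m n g m⊥n = trans (∏.big-cong M (λ q _ _ → split q)) (∏.big-∙ M _ _)
  where
  split : ∀ q → onPrimeDivisors (m ℕ.* n) g q ≡ onPrimeDivisors m g q * onPrimeDivisors n g q
  split q with prime? q
  ... | no _   = refl
  ... | yes pq rewrite ∣?-* q m n pq with q ∣? m | q ∣? n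
  ...   | yes q∣m | yes q∣n = ⊥-elim (prime⇒≢1 pq (m⊥n (q∣m , q∣n)))
  ...   | yes _   | no _    = sym (ℚP.*-identityʳ _)
  ...   | no _    | yes _   = sym (ℚP.*-identityˡ _)
  ...   | no _    | no _    = refl

primeProduct-prime : ∀ M p (g : ℕ → ℚ) → Prime p → p ≤ M → primeProduct M p g ≡ g p
primeProduct-prime M p g pp p≤M = trans (∏.big-single M p (prime⇒1≤ pp) p≤M (λ q _ _ → other q)) at-p
  where
  other : ∀ q → q ≢ p → onPrimeDivisors p g q ≡ 1ℚ
  other q q≢p with prime? q
  ... | no _   = refl
  ... | yes pq rewrite dec-false (q ∣? p) (q≢p ∘ prime∣prime⇒≡ pq pp) = refl
  at-p : onPrimeDivisors p g p ≡ g p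
  at-p rewrite dec-true (prime? p) pp | dec-true (p ∣? p) ∣-refl = refl

primeProduct-prime-* : ∀ M p m (g : ℕ → ℚ) → Prime p → ¬ p ∣ m → p ≤ M → primeProduct M (p ℕ.* m) g ≡ g p * primeProduct M m g
primeProduct-prime-* M p m g pp p∤m p≤M =
  trans (primeProduct-* M p m g (prime∤⇒coprime pp p∤m)) (cong (_* primeProduct M m g) (primeProduct-prime M p g pp p≤M))

-- The Möbius function

private
  squareDivisor? : ∀ d → Dec (Any (λ p → (p ℕ.* p) ∣ d) (primesOf d))
  squareDivisor? d = any? (λ p → (p ℕ.* p) ∣? d) (primesOf d)

  μ′ : Bool → List ℕ → ℚ
  μ′ b ps = if b then 0ℚ else prodℚ (map (λ _ → - 1ℚ) ps)

  μ≡μ′ : ∀ d → μ d ≡ μ′ (does (squareDivisor? d)) (primesOf d)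
  μ≡μ′ d = refl

∈-primesOf⁻ : ∀ {q d} → q ∈ primesOf d → Prime q × q ∣ d
∈-primesOf⁻ {d = d} q∈ = proj₂ (∈P.∈-filter⁻ (λ p → prime? p ×-dec (p ∣? d)) {xs = range1 d} q∈)

∈-primesOf⁺ : ∀ {q d} → 1 ≤ d → Prime q → q ∣ d → q ∈ primesOf d
∈-primesOf⁺ {zero}  _   pq _   = ⊥-elim (ℕP.<-irrefl refl (prime⇒1≤ pq))
∈-primesOf⁺ {suc q} {suc d} _ pq q∣d =
  ∈P.∈-filter⁺ (λ p → prime? p ×-dec (p ∣? suc d)) (∈P.∈-map⁺ suc (∈P.∈-upTo⁺ (∣⇒≤ q∣d))) (pq , q∣d)

private
  squareDivisor⁻ : ∀ {d} → Any (λ p → (p ℕ.* p) ∣ d) (primesOf d) → ∃ λ q → Prime q × (q ℕ.* q) ∣ d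
  squareDivisor⁻ {d} any with find any
  ... | q , q∈ , qq∣d = q , proj₁ (∈-primesOf⁻ {q} {d} q∈) , qq∣d

  squareDivisor⁺ : ∀ {d q} → 1 ≤ d → Prime q → (q ℕ.* q) ∣ d → Any (λ p → (p ℕ.* p) ∣ d) (primesOf d)
  squareDivisor⁺ {q = q} 1≤d pq qq∣d = lose (∈-primesOf⁺ 1≤d pq (∣-trans (m∣m*n q) qq∣d)) qq∣d

μ-p*p∣ : ∀ d p → 1 ≤ d → Prime p → (p ℕ.* p) ∣ d → μ d ≡ 0ℚ
μ-p*p∣ d p 1≤d pp pp∣d rewrite μ≡μ′ d | dec-true (squareDivisor? d) (squareDivisor⁺ 1≤d pp pp∣d) = refl

μ-prime-* : ∀ p e → Prime p → ¬ p ∣ e → 1 ≤ e → μ (p ℕ.* e) ≡ - μ e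
μ-prime-* p e pp p∤e 1≤e = begin
  μ (p ℕ.* e)                                       ≡⟨ cong (λ b → μ′ b (primesOf (p ℕ.* e))) squarefree⇔ ⟩
  μ′ (does (squareDivisor? e)) (primesOf (p ℕ.* e)) ≡⟨ negate (does (squareDivisor? e)) ⟩
  - μ e                                             ∎
  where
  open ≡-Reasoning
  instance
    _ = ℕ.>-nonZero 1≤e
    _ = ℕ.>-nonZero (prime⇒1≤ pp)
  1≤pe : 1 ≤ p ℕ.* e
  1≤pe = ℕP.*-mono-≤ (prime⇒1≤ pp) 1≤e
  minus1 : ℕ → ℚ
  minus1 _ = - 1ℚ
  one-more-prime : prodℚ (map minus1 (primesOf (p ℕ.* e))) ≡ - prodℚ (map minus1 (primesOf e))
  one-more-prime = begin
    prodℚ (map minus1 (primesOf (p ℕ.* e)))  ≡⟨ prodℚ-primesOf (p ℕ.* e) (p ℕ.* e) minus1 1≤pe ℕP.≤-refl ⟩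
    primeProduct (p ℕ.* e) (p ℕ.* e) minus1  ≡⟨ primeProduct-prime-* (p ℕ.* e) p e minus1 pp p∤e (ℕP.m≤m*n p e) ⟩
    - 1ℚ * primeProduct (p ℕ.* e) e minus1   ≡⟨ cong (- 1ℚ *_) (prodℚ-primesOf e (p ℕ.* e) minus1 1≤e (ℕP.m≤n*m e p)) ⟨
    - 1ℚ * prodℚ (map minus1 (primesOf e))   ≡⟨ ℚP.neg-distribˡ-* 1ℚ (prodℚ (map minus1 (primesOf e))) ⟨
    - (1ℚ * prodℚ (map minus1 (primesOf e))) ≡⟨ cong -_ (ℚP.*-identityˡ (prodℚ (map minus1 (primesOf e)))) ⟩
    - prodℚ (map minus1 (primesOf e))        ∎
  negate : ∀ b → μ′ b (primesOf (p ℕ.* e)) ≡ - μ′ b (primesOf e)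
  negate true  = refl
  negate false = one-more-prime
  p∤q⇒qq∣e : ∀ {q} → Prime q → q ≢ p → (q ℕ.* q) ∣ (p ℕ.* e) → (q ℕ.* q) ∣ e
  p∤q⇒qq∣e {q} pq q≢p = coprime-divisor (coprime-* q⊥p q⊥p)
    where
    q⊥p : Coprime q p
    q⊥p = prime∤⇒coprime pq (q≢p ∘ prime∣prime⇒≡ pq pp)
  squarefree⇔ : does (squareDivisor? (p ℕ.* e)) ≡ does (squareDivisor? e)
  squarefree⇔ = does-⇔ (squareDivisor? (p ℕ.* e)) (squareDivisor? e) fwd bwd
    where
    HasSquareDivisor : ℕ → Set
    HasSquareDivisor d = Any (λ q → (q ℕ.* q) ∣ d) (primesOf d)
    fwd : HasSquareDivisor (p ℕ.* e) → HasSquareDivisor e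
    fwd any with squareDivisor⁻ any
    ... | q , pq , qq∣pe with q ℕP.≟ p
    ...   | yes refl = ⊥-elim (p∤e (*-cancelˡ-∣ p qq∣pe))
    ...   | no q≢p   = squareDivisor⁺ 1≤e pq (p∤q⇒qq∣e pq q≢p qq∣pe)
    bwd : HasSquareDivisor e → HasSquareDivisor (p ℕ.* e)
    bwd any with squareDivisor⁻ any
    ... | q , pq , qq∣e = squareDivisor⁺ 1≤pe pq (∣n⇒∣m*n p qq∣e)

-- The product formula ∑_{d ∣ n} μ(d) h(d) = ∏_{p ∣ n} (1 - h(p))

MultiplicativeOn : ℕ → (ℕ → ℚ) → Set
MultiplicativeOn n h = ∀ p e → Prime p → ¬ p ∣ e → (p ℕ.* e) ∣ n → h (p ℕ.* e) ≡ h p * h e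

MöbiusProductFormula : ℕ → ℕ → (ℕ → ℚ) → Set
MöbiusProductFormula n M h = divisorSum n (λ d → μ d * h d) ≡ primeProduct M n (λ q → 1ℚ - h q)

∑-multiples : ∀ p m (G : ℕ → ℚ) → 1 ≤ p →
  ∑.big (p ℕ.* m) (λ d → if does (p ∣? d) then G d else 0ℚ) ≡ ∑.big m (λ e → G (p ℕ.* e))
∑-multiples p zero    G 1≤p = cong (λ t → ∑.big t (λ d → if does (p ∣? d) then G d else 0ℚ)) (ℕP.*-zeroʳ p)
∑-multiples p (suc m) G 1≤p = begin
  ∑.big (p ℕ.* suc m) H                                  ≡⟨ cong (λ t → ∑.big t H) p[1+m]≡pm+p ⟩
  ∑.big (p ℕ.* m ℕ.+ p) H                                ≡⟨ ∑.big-+ (p ℕ.* m) p H ⟩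
  ∑.big (p ℕ.* m) H + ∑.big p (λ j → H (p ℕ.* m ℕ.+ j)) ≡⟨ cong₂ _+_ (∑-multiples p m G 1≤p) (∑.big-single p p 1≤p ℕP.≤-refl between) ⟩
  ∑.big m (λ e → G (p ℕ.* e)) + H (p ℕ.* m ℕ.+ p)        ≡⟨ cong (λ t → ∑.big m (λ e → G (p ℕ.* e)) + t) last ⟩
  ∑.big (suc m) (λ e → G (p ℕ.* e))                      ∎
  where
  open ≡-Reasoning
  H : ℕ → ℚ
  H d = if does (p ∣? d) then G d else 0ℚ
  p[1+m]≡pm+p : p ℕ.* suc m ≡ p ℕ.* m ℕ.+ p
  p[1+m]≡pm+p = trans (ℕP.*-suc p m) (ℕP.+-comm p (p ℕ.* m))
  between : ∀ j → 1 ≤ j → j ≤ p → j ≢ p → H (p ℕ.* m ℕ.+ j) ≡ 0ℚ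
  between j 1≤j j≤p j≢p with p ∣? (p ℕ.* m ℕ.+ j)
  ... | no _   = refl
  ... | yes p∣ = ⊥-elim (ℕP.<⇒≱ (ℕP.≤∧≢⇒< j≤p j≢p) (∣⇒≤ {{ℕ.>-nonZero 1≤j}} (∣m+n∣m⇒∣n p∣ (m∣m*n m))))
  last : H (p ℕ.* m ℕ.+ p) ≡ G (p ℕ.* suc m)
  last rewrite sym p[1+m]≡pm+p | dec-true (p ∣? (p ℕ.* suc m)) (m∣m*n (suc m)) = refl

divisorSum-extend : ∀ n M F → 1 ≤ n → n ≤ M → ∑.big M (onDivisors n F) ≡ divisorSum n F
divisorSum-extend n M F 1≤n n≤M = ∑.big-extend n M n≤M beyond
  where
  beyond : ∀ k → n < k → k ≤ M → onDivisors n F k ≡ 0ℚ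
  beyond k n<k _ rewrite dec-false (k ∣? n) (>⇒∤ 1≤n n<k) = refl

∣p*n∧∤n⇒p*p∣ : ∀ p n d → Prime p → p ∣ n → d ∣ p ℕ.* n → ¬ d ∣ n → (p ℕ.* p) ∣ d
∣p*n∧∤n⇒p*p∣ p n d pp p∣n d∣pn d∤n with p ∣? d
... | no p∤d = ⊥-elim (d∤n (coprime-divisor (Coprimality.sym (prime∤⇒coprime pp p∤d)) d∣pn))
... | yes (divides d′ refl) with p ∣? d′
...   | yes p∣d′ = subst ((p ℕ.* p) ∣_) (ℕP.*-comm p d′) (*-monoʳ-∣ p p∣d′)
...   | no p∤d′  = ⊥-elim (d∤n d′p∣n)
  where
  instance _ = ℕ.>-nonZero (prime⇒1≤ pp)
  d′p∣n : (d′ ℕ.* p) ∣ n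
  d′p∣n with *-cancelˡ-∣ p (subst (_∣ p ℕ.* n) (ℕP.*-comm d′ p) d∣pn)
  ... | divides t n≡td′ with euclidsLemma t d′ pp (subst (p ∣_) n≡td′ p∣n)
  ...   | inj₂ p∣d′ = ⊥-elim (p∤d′ p∣d′)
  ...   | inj₁ p∣t  = subst ((d′ ℕ.* p) ∣_) (trans (ℕP.*-comm d′ t) (sym n≡td′)) (*-pres-∣ (∣-refl {d′}) p∣t)

möbius-product-*-∣ : ∀ p n M h → Prime p → p ∣ n → 1 ≤ n →
  MöbiusProductFormula n M h → MöbiusProductFormula (p ℕ.* n) M h
möbius-product-*-∣ p n M h pp p∣n 1≤n formula = begin
  divisorSum (p ℕ.* n) F              ≡⟨ ∑.big-cong (p ℕ.* n) (λ d 1≤d _ → μ-kills d 1≤d) ⟩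
  ∑.big (p ℕ.* n) (onDivisors n F)    ≡⟨ divisorSum-extend n (p ℕ.* n) F 1≤n (ℕP.m≤n*m n p) ⟩
  divisorSum n F                      ≡⟨ formula ⟩
  primeProduct M n g                  ≡⟨ primeProduct-radical M n (p ℕ.* n) g (λ q _ → ∣n⇒∣m*n p) q∣pn⇒q∣n ⟩
  primeProduct M (p ℕ.* n) g          ∎
  where
  open ≡-Reasoning
  instance _ = ℕ.>-nonZero (prime⇒1≤ pp)
  F : ℕ → ℚ
  F d = μ d * h d
  g : ℕ → ℚ
  g q = 1ℚ - h q
  μ-kills : ∀ d → 1 ≤ d → onDivisors (p ℕ.* n) F d ≡ onDivisors n F d
  μ-kills d 1≤d with d ∣? (p ℕ.* n) | d ∣? n
  ... | yes _    | yes _   = refl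
  ... | no _     | no _    = refl
  ... | no d∤pn  | yes d∣n = ⊥-elim (d∤pn (∣n⇒∣m*n p d∣n))
  ... | yes d∣pn | no d∤n  =
    trans (cong (_* h d) (μ-p*p∣ d p 1≤d pp (∣p*n∧∤n⇒p*p∣ p n d pp p∣n d∣pn d∤n))) (ℚP.*-zeroˡ (h d))
  q∣pn⇒q∣n : ∀ q → Prime q → q ∣ p ℕ.* n → q ∣ n
  q∣pn⇒q∣n q pq q∣pn with euclidsLemma p n pq q∣pn
  ... | inj₂ q∣n = q∣n
  ... | inj₁ q∣p rewrite prime∣prime⇒≡ pq pp q∣p = p∣n

-- The divisors of p n are the divisors e of n together with the p e, and μ(p e) h(p e) = - h(p) μ(e) h(e).
möbius-product-*-∤ : ∀ p n M h → Prime p → ¬ p ∣ n → 1 ≤ n → p ℕ.* n ≤ M → MultiplicativeOn (p ℕ.* n) h →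
  MöbiusProductFormula n M h → MöbiusProductFormula (p ℕ.* n) M h
möbius-product-*-∤ p n M h pp p∤n 1≤n pn≤M mult formula = begin
  divisorSum (p ℕ.* n) F             ≡⟨ ∑.big-partition (p ℕ.* n) (λ d → does (p ∣? d)) _ ⟩
  multiples + others                 ≡⟨ cong₂ _+_ multiples≡ others≡ ⟩
  - h p * divisorSum n F + divisorSum n F ≡⟨ factor (h p) (divisorSum n F) ⟩
  (1ℚ - h p) * divisorSum n F        ≡⟨ cong ((1ℚ - h p) *_) formula ⟩
  g p * primeProduct M n g           ≡⟨ primeProduct-prime-* M p n g pp p∤n (ℕP.≤-trans (ℕP.m≤m*n p n) pn≤M) ⟨
  primeProduct M (p ℕ.* n) g         ∎
  where
  open ≡-Reasoning
  instance
    _ = ℕ.>-nonZero (prime⇒1≤ pp)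
    _ = ℕ.>-nonZero 1≤n
  F : ℕ → ℚ
  F d = μ d * h d
  g : ℕ → ℚ
  g q = 1ℚ - h q
  D : ℕ → ℚ
  D = onDivisors (p ℕ.* n) F
  multiples others : ℚ
  multiples = ∑.big (p ℕ.* n) (λ d → if does (p ∣? d) then D d else 0ℚ)
  others    = ∑.big (p ℕ.* n) (λ d → if does (p ∣? d) then 0ℚ else D d)
  factor : ∀ x y → - x * y + y ≡ (1ℚ - x) * y
  factor = solve 2 (λ x y → (:- x) :* y :+ y := (con 1ℚ :- x) :* y) refl
  D-at-multiple : ∀ e → D (p ℕ.* e) ≡ - h p * onDivisors n F e
  D-at-multiple e with (p ℕ.* e) ∣? (p ℕ.* n) | e ∣? n
  ... | yes pe∣pn | no e∤n = ⊥-elim (e∤n (*-cancelˡ-∣ p pe∣pn))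
  ... | no pe∤pn  | yes e∣n = ⊥-elim (pe∤pn (*-monoʳ-∣ p e∣n))
  ... | no _      | no _    = sym (ℚP.*-zeroʳ (- h p))
  ... | yes pe∣pn | yes e∣n = begin
    μ (p ℕ.* e) * h (p ℕ.* e) ≡⟨ cong₂ _*_ (μ-prime-* p e pp p∤e (∣⇒1≤ 1≤n e∣n)) (mult p e pp p∤e pe∣pn) ⟩
    - μ e * (h p * h e)       ≡⟨ solve 3 (λ m x y → (:- m) :* (x :* y) := (:- x) :* (m :* y)) refl (μ e) (h p) (h e) ⟩
    - h p * (μ e * h e)       ∎
    where
    p∤e : ¬ p ∣ e
    p∤e p∣e = p∤n (∣-trans p∣e e∣n)
  multiples≡ : multiples ≡ - h p * divisorSum n F
  multiples≡ = begin
    multiples                                     ≡⟨ ∑-multiples p n D (prime⇒1≤ pp) ⟩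
    ∑.big n (λ e → D (p ℕ.* e))                   ≡⟨ ∑.big-cong n (λ e _ _ → D-at-multiple e) ⟩
    ∑.big n (λ e → - h p * onDivisors n F e)      ≡⟨ ∑-*-distribˡ n (- h p) _ ⟨
    - h p * divisorSum n F                        ∎
  non-multiple : ∀ d → (if does (p ∣? d) then 0ℚ else D d) ≡ onDivisors n F d
  non-multiple d with p ∣? d | d ∣? (p ℕ.* n) | d ∣? n
  ... | yes _   | _       | no _    = refl
  ... | yes p∣d | _       | yes d∣n = ⊥-elim (p∤n (∣-trans p∣d d∣n))
  ... | no _    | yes _   | yes _   = refl
  ... | no _    | no _    | no _    = refl
  ... | no _    | no d∤pn | yes d∣n = ⊥-elim (d∤pn (∣n⇒∣m*n p d∣n))
  ... | no p∤d  | yes d∣pn | no d∤n = ⊥-elim (d∤n (coprime-divisor (Coprimality.sym (prime∤⇒coprime pp p∤d)) d∣pn))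
  others≡ : others ≡ divisorSum n F
  others≡ = trans (∑.big-cong (p ℕ.* n) (λ d _ _ → non-multiple d)) (divisorSum-extend n (p ℕ.* n) F 1≤n (ℕP.m≤n*m n p))

möbius-product : ∀ n → 1 ≤ n → ∀ M → n ≤ M → (h : ℕ → ℚ) → h 1 ≡ 1ℚ → MultiplicativeOn n h → MöbiusProductFormula n M h
möbius-product = <-rec Claim step
  where
  Claim : ℕ → Set
  Claim n = 1 ≤ n → ∀ M → n ≤ M → (h : ℕ → ℚ) → h 1 ≡ 1ℚ → MultiplicativeOn n h → MöbiusProductFormula n M h
  step : ∀ n → WfRec _<_ Claim n → Claim n
  step (suc zero) _ _ M _ h h1≡1 _ = trans (cong (λ x → 0ℚ + 1ℚ * x) h1≡1) (sym (primeProduct-1 M (λ q → 1ℚ - h q)))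
  step n@(suc (suc _)) rec _ M n≤M h h1≡1 mult with ∃prime∣ n (s≤s (s≤s z≤n))
  ... | p , pp , divides m@(suc _) n≡mp = subst (λ k → MöbiusProductFormula k M h) (sym n≡pm) formula-pm
    where
    n≡pm : n ≡ p ℕ.* m
    n≡pm = trans n≡mp (ℕP.*-comm m p)
    m<n : m < n
    m<n = subst (m <_) (sym n≡mp) (ℕP.m<m*n m p (prime⇒2≤ pp))
    pm≤M : p ℕ.* m ≤ M
    pm≤M = subst (_≤ M) n≡pm n≤M
    formula-m : MöbiusProductFormula m M h
    formula-m = rec m<n (s≤s z≤n) M (ℕP.≤-trans (ℕP.<⇒≤ m<n) n≤M) h h1≡1
      (λ a b pa a∤b ab∣m → mult a b pa a∤b (∣-trans ab∣m (divides p n≡pm)))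
    formula-pm : MöbiusProductFormula (p ℕ.* m) M h
    formula-pm with p ∣? m
    ... | yes p∣m = möbius-product-*-∣ p m M h pp p∣m (s≤s z≤n) formula-m
    ... | no p∤m  = möbius-product-*-∤ p m M h pp p∤m (s≤s z≤n) pm≤M
                      (λ a b pa a∤b ab∣pm → mult a b pa a∤b (subst ((a ℕ.* b) ∣_) (sym n≡pm) ab∣pm)) formula-m

frac-1-multiplicative : ∀ n → MultiplicativeOn n (frac 1)
frac-1-multiplicative n p e _ _ _ = frac-1-* p e

multiplicative-* : ∀ n f g → MultiplicativeOn n f → MultiplicativeOn n g → MultiplicativeOn n (λ d → f d * g d)
multiplicative-* n f g f-mult g-mult p e pp p∤e pe∣n =
  trans (cong₂ _*_ (f-mult p e pp p∤e pe∣n) (g-mult p e pp p∤e pe∣n)) (interchange (f p) (f e) (g p) (g e))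
  where
  interchange : ∀ a b c d → (a * b) * (c * d) ≡ (a * c) * (b * d)
  interchange = solve 4 (λ a b c d → (a :* b) :* (c :* d) := (a :* c) :* (b :* d)) refl

primeProduct-multiplicative : ∀ M n g → 1 ≤ n → n ≤ M → MultiplicativeOn n (λ d → primeProduct M d g)
primeProduct-multiplicative M n g 1≤n n≤M p e pp p∤e pe∣n =
  trans (primeProduct-prime-* M p e g pp p∤e p≤M) (cong (_* primeProduct M e g) (sym (primeProduct-prime M p g pp p≤M)))
  where
  p≤M : p ≤ M
  p≤M = ℕP.≤-trans (∣⇒≤ {{ℕ.>-nonZero 1≤n}} (∣-trans (m∣m*n e) pe∣n)) n≤M

coprimePart : ℕ → (ℕ → ℚ) → ℕ → ℚ
coprimePart m f d = if does (coprime? d m) then f d else 0ℚ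

coprimePart-1 : ∀ m f → f 1 ≡ 1ℚ → coprimePart m f 1 ≡ 1ℚ
coprimePart-1 m f f1≡1 rewrite dec-true (coprime? 1 m) (coprime-1 m) = f1≡1

coprimePart-prime : ∀ m f q → Prime q → coprimePart m f q ≡ (if not (does (q ∣? m)) then f q else 0ℚ)
coprimePart-prime m f q pq = cong (λ b → if b then f q else 0ℚ) (coprime?-prime q m pq)

-- `does (coprime? d m)` unfolds, so `with` cannot abstract it: here and below the decisions are passed explicitly.
coprimePart-multiplicative : ∀ n m f → MultiplicativeOn n f → MultiplicativeOn n (coprimePart m f)
coprimePart-multiplicative n m f f-mult p e pp p∤e pe∣n = by-cases (coprime? (p ℕ.* e) m) (coprime? p m) (coprime? e m)
  where
  part : ∀ {d} → Dec (Coprime d m) → ℚ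
  part {d} d⊥m? = if does d⊥m? then f d else 0ℚ
  by-cases : ∀ pe⊥m? p⊥m? e⊥m? → part {p ℕ.* e} pe⊥m? ≡ part {p} p⊥m? * part {e} e⊥m?
  by-cases (yes _)     (yes _)     (yes _)     = f-mult p e pp p∤e pe∣n
  by-cases (yes pe⊥m)  (no p̸⊥m)    _           = ⊥-elim (p̸⊥m (coprime-*ˡ pe⊥m))
  by-cases (yes pe⊥m)  (yes _)     (no e̸⊥m)    = ⊥-elim (e̸⊥m (coprime-*ʳ {p} pe⊥m))
  by-cases (no pe̸⊥m)   (yes p⊥m)   (yes e⊥m)   = ⊥-elim (pe̸⊥m (coprime-* p⊥m e⊥m))
  by-cases (no _)      (no _)      e⊥m?        = sym (ℚP.*-zeroˡ (part e⊥m?))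
  by-cases (no _)      (yes _)     (no _)      = sym (ℚP.*-zeroʳ (f p))

-- The factors at a prime q of the product formulas for the weight of η₂ in T₂ and for ψ ν̃,
-- with A, B, C, E recording whether q divides η₁, η₂, η₃, η₄, T whether q = 2, and x = 1/q, y = 2/q.
weightFactor : Bool → Bool → Bool → Bool → ℚ → ℚ
weightFactor A B C E x =
  (if A ∨ B then 1ℚ - x′ else 1ℚ) * (if A then 1ℚ - (if not (B ∨ C) then x * invℚ (1ℚ - x′) else 0ℚ) else 1ℚ)
  where x′ = if not E then x else 0ℚ

ψνFactor : Bool → Bool → Bool → Bool → Bool → ℚ → ℚ → ℚ
ψνFactor A B C E T x y =
  ((if A ∧ (C ∨ E) then 1ℚ - x else 1ℚ) * (if A then (if C ∨ E then 1ℚ else (if not T then 1ℚ - y else 1ℚ)) else 1ℚ)) *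
  ((if B then 1ℚ - x else 1ℚ) * (if A ∧ B then (if not T then invℚ (1ℚ - y) else 1ℚ) else 1ℚ))

weightFactor≡ψνFactor : ∀ A B C E T x y → B ∧ (C ∨ E) ≡ false → C ∧ E ≡ false → T ∧ (A ∧ (not B ∧ not (C ∨ E))) ≡ false →
  y ≡ x + x → (1ℚ - x) * invℚ (1ℚ - x) ≡ 1ℚ → (T ≡ false → (1ℚ - y) * invℚ (1ℚ - y) ≡ 1ℚ) →
  weightFactor A B C E x ≡ ψνFactor A B C E T x y
weightFactor≡ψνFactor false false C     E     T     x y _  _  _  _    _ _ = refl
weightFactor≡ψνFactor _     true  true  E     T     x y () _  _  _    _ _
weightFactor≡ψνFactor _     true  false true  T     x y () _  _  _    _ _
weightFactor≡ψνFactor false true  false false T     x y _  _  _  _    _ _ =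
  solve 1 (λ x → (con 1ℚ :- x) :* con 1ℚ := (con 1ℚ :* con 1ℚ) :* ((con 1ℚ :- x) :* con 1ℚ)) refl x
weightFactor≡ψνFactor true  true  false false true  x y _  _  _  _    _ _ =
  solve 1 (λ x → (con 1ℚ :- x) :* (con 1ℚ :- con 0ℚ) := (con 1ℚ :* con 1ℚ) :* ((con 1ℚ :- x) :* con 1ℚ)) refl x
weightFactor≡ψνFactor true  true  false false false x y _  _  _  _    _ inv-y = begin
  (1ℚ - x) * (1ℚ - 0ℚ)                               ≡⟨ solve 1 (λ x → (con 1ℚ :- x) :* (con 1ℚ :- con 0ℚ) := (con 1ℚ :- x) :* con 1ℚ) refl x ⟩
  (1ℚ - x) * 1ℚ                                      ≡⟨ cong ((1ℚ - x) *_) (inv-y refl) ⟨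
  (1ℚ - x) * ((1ℚ - y) * invℚ (1ℚ - y))              ≡⟨ solve 3 (λ x y w → (con 1ℚ :- x) :* ((con 1ℚ :- y) :* w) := (con 1ℚ :* (con 1ℚ :- y)) :* ((con 1ℚ :- x) :* w)) refl x y (invℚ (1ℚ - y)) ⟩
  (1ℚ * (1ℚ - y)) * ((1ℚ - x) * invℚ (1ℚ - y))       ∎
  where open ≡-Reasoning
weightFactor≡ψνFactor true  false true  true  T     x y _  () _  _    _ _
weightFactor≡ψνFactor true  false true  false T     x y _  _  _  _    _ _ =
  solve 1 (λ x → (con 1ℚ :- x) :* (con 1ℚ :- con 0ℚ) := ((con 1ℚ :- x) :* con 1ℚ) :* (con 1ℚ :* con 1ℚ)) refl x
weightFactor≡ψνFactor true  false false true  T     x y _  _  _  _    _ _ =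
  solve 1 (λ x → (con 1ℚ :- con 0ℚ) :* (con 1ℚ :- x :* con (invℚ (1ℚ - 0ℚ))) := ((con 1ℚ :- x) :* con 1ℚ) :* (con 1ℚ :* con 1ℚ)) refl x
weightFactor≡ψνFactor true  false false false true  x y _  _  () _    _ _
weightFactor≡ψνFactor true  false false false false x y _  _  _  y≡2x inv-x _ = begin
  (1ℚ - x) * (1ℚ - x * invℚ (1ℚ - x))                ≡⟨ solve 2 (λ x w → (con 1ℚ :- x) :* (con 1ℚ :- x :* w) := (con 1ℚ :- x) :- x :* ((con 1ℚ :- x) :* w)) refl x (invℚ (1ℚ - x)) ⟩
  (1ℚ - x) - x * ((1ℚ - x) * invℚ (1ℚ - x))          ≡⟨ cong (λ t → (1ℚ - x) - x * t) inv-x ⟩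
  (1ℚ - x) - x * 1ℚ                                  ≡⟨ solve 1 (λ x → (con 1ℚ :- x) :- x :* con 1ℚ := con 1ℚ :- (x :+ x)) refl x ⟩
  1ℚ - (x + x)                                       ≡⟨ cong (λ t → 1ℚ - t) y≡2x ⟨
  1ℚ - y                                             ≡⟨ solve 1 (λ y → con 1ℚ :- y := (con 1ℚ :* (con 1ℚ :- y)) :* (con 1ℚ :* con 1ℚ)) refl y ⟩
  (1ℚ * (1ℚ - y)) * (1ℚ * 1ℚ)                        ∎
  where open ≡-Reasoning

-- Evaluation of the weight of η₂ in T₂

module InnerWeight (η₁ η₂ η₃ η₄ : ℕ) (1≤η₁ : 1 ≤ η₁) (1≤η₂ : 1 ≤ η₂)
                   (η₃⊥η₄ : Coprime η₃ η₄) (η₂⊥η₃η₄ : Coprime η₂ (η₃ ℕ.* η₄)) where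

  M : ℕ
  M = η₁ ℕ.* η₂

  instance
    _ = ℕ.>-nonZero 1≤η₁
    _ = ℕ.>-nonZero 1≤η₂

  η₁≤M : η₁ ≤ M
  η₁≤M = ℕP.m≤m*n η₁ η₂

  η₂≤M : η₂ ≤ M
  η₂≤M = ℕP.m≤n*m η₂ η₁

  1≤M : 1 ≤ M
  1≤M = ℕP.*-mono-≤ 1≤η₁ 1≤η₂

  a : ℕ → ℚ
  a q = 1ℚ - coprimePart η₄ (frac 1) q

  a⁻¹ : ℕ → ℚ
  a⁻¹ q = invℚ (a q)

  a-prime : ∀ q → Prime q → a q ≡ 1ℚ - (if not (does (q ∣? η₄)) then frac 1 q else 0ℚ)
  a-prime q pq = cong (λ t → 1ℚ - t) (coprimePart-prime η₄ (frac 1) q pq)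

  a*a⁻¹ : ∀ q → Prime q → a q * a⁻¹ q ≡ 1ℚ
  a*a⁻¹ q pq = *-invℚ (a q) (subst (_≢ 0ℚ) (sym (a-prime q pq)) (nonzero (q ∣? η₄)))
    where
    nonzero : (q∣η₄? : Dec (q ∣ η₄)) → 1ℚ - (if not (does q∣η₄?) then frac 1 q else 0ℚ) ≢ 0ℚ
    nonzero (yes _) ()
    nonzero (no _)  = 1-frac≢0 1 q (prime⇒1≤ pq) (prime⇒≢1 pq ∘ sym)

  innerSum : ℕ → ℚ
  innerSum k = sumℚ (map (λ k₂ → μ k₂ * frac 1 k₂) (filter (λ k₂ → coprime? k₂ (k ℕ.* η₄)) (divisors M)))

  innerSum≡ : ∀ k → 1 ≤ k → k ∣ η₁ → innerSum k ≡ primeProduct M M a * primeProduct M k a⁻¹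
  innerSum≡ k 1≤k k∣η₁ = begin
    innerSum k                                 ≡⟨ ∑.fold-filter (λ k₂ → coprime? k₂ (k ℕ.* η₄)) (λ k₂ → μ k₂ * frac 1 k₂) (divisors M) ⟩
    sumℚ (map _ (divisors M))                  ≡⟨ sumℚ-divisors M _ ⟩
    divisorSum M _                             ≡⟨ ∑.big-cong M (λ d _ _ → cong (λ t → if does (d ∣? M) then t else 0ℚ) (pull (coprime? d (k ℕ.* η₄)))) ⟩
    divisorSum M (λ d → μ d * h d)             ≡⟨ möbius-product M 1≤M M ℕP.≤-refl h (coprimePart-1 (k ℕ.* η₄) (frac 1) refl) h-multiplicative ⟩
    primeProduct M M (λ q → 1ℚ - h q)          ≡⟨ ∏.big-cong M (λ q _ _ → split q) ⟩
    ∏.big M (λ q → onPrimeDivisors M a q * onPrimeDivisors k a⁻¹ q) ≡⟨ ∏.big-∙ M _ _ ⟩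
    primeProduct M M a * primeProduct M k a⁻¹  ∎
    where
    open ≡-Reasoning
    h : ℕ → ℚ
    h = coprimePart (k ℕ.* η₄) (frac 1)
    h-multiplicative : MultiplicativeOn M h
    h-multiplicative = coprimePart-multiplicative M (k ℕ.* η₄) (frac 1) (frac-1-multiplicative M)
    pull : ∀ {d} (d⊥kη₄? : Dec (Coprime d (k ℕ.* η₄))) →
      (if does d⊥kη₄? then μ d * frac 1 d else 0ℚ) ≡ μ d * (if does d⊥kη₄? then frac 1 d else 0ℚ)
    pull     (yes _) = refl
    pull {d} (no _) = sym (ℚP.*-zeroʳ (μ d))
    h-prime : ∀ q → Prime q → h q ≡ (if not (does (q ∣? (k ℕ.* η₄))) then frac 1 q else 0ℚ)
    h-prime = coprimePart-prime (k ℕ.* η₄) (frac 1)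
    split : ∀ q → onPrimeDivisors M (λ q → 1ℚ - h q) q ≡ onPrimeDivisors M a q * onPrimeDivisors k a⁻¹ q
    split q with prime? q | q ∣? M | q ∣? k
    ... | no _   | _      | _       = refl
    ... | yes _  | no _   | no _    = refl
    ... | yes _  | no q∤M | yes q∣k = ⊥-elim (q∤M (∣-trans q∣k (∣-trans k∣η₁ (m∣m*n η₂))))
    ... | yes pq | yes _  | yes q∣k
      rewrite h-prime q pq | dec-true (q ∣? (k ℕ.* η₄)) (∣m⇒∣m*n η₄ q∣k) = sym (a*a⁻¹ q pq)
    ... | yes pq | yes _  | no q∤k
      rewrite h-prime q pq | ∣?-* q k η₄ pq | dec-false (q ∣? k) q∤k | a-prime q pq = sym (ℚP.*-identityʳ _)

  g : ℕ → ℚ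
  g k = frac 1 k * primeProduct M k a⁻¹

  h₂ : ℕ → ℚ
  h₂ = coprimePart (η₂ ℕ.* η₃) g

  h₂-multiplicative : MultiplicativeOn η₁ h₂
  h₂-multiplicative = coprimePart-multiplicative η₁ (η₂ ℕ.* η₃) g
    (multiplicative-* η₁ (frac 1) _ (frac-1-multiplicative η₁) (primeProduct-multiplicative M η₁ a⁻¹ 1≤η₁ η₁≤M))

  innerWeight≡ : innerWeight η₁ η₂ η₃ η₄ ≡ primeProduct M M a * primeProduct M η₁ (λ q → 1ℚ - h₂ q)
  innerWeight≡ = begin
    innerWeight η₁ η₂ η₃ η₄                  ≡⟨ ∑.fold-filter (λ k → coprime? k (η₂ ℕ.* η₃)) (λ k → (μ k * frac 1 k) * innerSum k) (divisors η₁) ⟩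
    sumℚ (map _ (divisors η₁))               ≡⟨ sumℚ-divisors η₁ _ ⟩
    divisorSum η₁ _                          ≡⟨ ∑.big-cong η₁ (λ k 1≤k _ → term k 1≤k) ⟩
    ∑.big η₁ (λ k → P * onDivisors η₁ (λ k → μ k * h₂ k) k) ≡⟨ ∑-*-distribˡ η₁ P _ ⟨
    P * divisorSum η₁ (λ k → μ k * h₂ k)     ≡⟨ cong (P *_) (möbius-product η₁ 1≤η₁ M η₁≤M h₂ h₂-1 h₂-multiplicative) ⟩
    P * primeProduct M η₁ (λ q → 1ℚ - h₂ q)  ∎
    where
    open ≡-Reasoning
    P : ℚ
    P = primeProduct M M a
    h₂-1 : h₂ 1 ≡ 1ℚ
    h₂-1 = coprimePart-1 (η₂ ℕ.* η₃) g (cong (frac 1 1 *_) (primeProduct-1 M a⁻¹))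
    regroup : ∀ m f P Q → (m * f) * (P * Q) ≡ P * (m * (f * Q))
    regroup = solve 4 (λ m f P Q → (m :* f) :* (P :* Q) := P :* (m :* (f :* Q))) refl
    term : ∀ k → 1 ≤ k →
      onDivisors η₁ (λ k → if does (coprime? k (η₂ ℕ.* η₃)) then (μ k * frac 1 k) * innerSum k else 0ℚ) k ≡
      P * onDivisors η₁ (λ k → μ k * h₂ k) k
    term k 1≤k with k ∣? η₁
    ... | no _    = sym (ℚP.*-zeroʳ P)
    ... | yes k∣η₁ = by-coprimality (coprime? k (η₂ ℕ.* η₃))
      where
      by-coprimality : (k⊥η₂η₃? : Dec (Coprime k (η₂ ℕ.* η₃))) →
        (if does k⊥η₂η₃? then (μ k * frac 1 k) * innerSum k else 0ℚ) ≡
        P * (μ k * (if does k⊥η₂η₃? then frac 1 k * primeProduct M k a⁻¹ else 0ℚ))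
      by-coprimality (yes _) = trans (cong ((μ k * frac 1 k) *_) (innerSum≡ k 1≤k k∣η₁)) (regroup (μ k) (frac 1 k) P _)
      by-coprimality (no _)  = sym (trans (cong (P *_) (ℚP.*-zeroʳ (μ k))) (ℚP.*-zeroʳ P))

  f₁ f₂ ψFactor ν̃Factor : ℕ → ℚ
  f₁ q = 1ℚ - frac 1 q
  f₂ q = 1ℚ - frac 2 q
  ψFactor q = if does (q ∣? (η₃ ℕ.* η₄)) then 1ℚ else (if not (q ℕ.≡ᵇ 2) then f₂ q else 1ℚ)
  ν̃Factor q = if not (q ℕ.≡ᵇ 2) then invℚ (f₂ q) else 1ℚ

  ψ≡ : ψ η₁ η₃ η₄ ≡ primeProduct M (gcd η₁ (η₃ ℕ.* η₄)) f₁ * primeProduct M η₁ ψFactor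
  ψ≡ = cong₂ _*_
    (prodℚ-primesOf (gcd η₁ (η₃ ℕ.* η₄)) M f₁ (1≤gcd η₁ _ 1≤η₁) (ℕP.≤-trans (∣⇒≤ (gcd[m,n]∣m η₁ _)) η₁≤M))
    (begin
      prodℚ (map f₂ (filter (λ p → ¬? (p ∣? (η₃ ℕ.* η₄)) ×-dec ¬? (p ℕ.≟ 2)) (primesOf η₁)))
        ≡⟨ ∏.fold-filter (λ p → ¬? (p ∣? (η₃ ℕ.* η₄)) ×-dec ¬? (p ℕ.≟ 2)) f₂ (primesOf η₁) ⟩
      prodℚ (map _ (primesOf η₁))
        ≡⟨ prodℚ-primesOf η₁ M _ 1≤η₁ η₁≤M ⟩
      primeProduct M η₁ _
        ≡⟨ primeProduct-cong M η₁ factor ⟩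
      primeProduct M η₁ ψFactor ∎)
    where
    open ≡-Reasoning
    factor : ∀ p → (if does (¬? (p ∣? (η₃ ℕ.* η₄)) ×-dec ¬? (p ℕ.≟ 2)) then f₂ p else 1ℚ) ≡ ψFactor p
    factor p with p ∣? (η₃ ℕ.* η₄)
    ... | yes _ = refl
    ... | no _  = refl

  ν̃≡ : νtilde η₁ η₃ η₄ η₂ ≡ primeProduct M η₂ f₁ * primeProduct M (gcd η₁ η₂) ν̃Factor
  ν̃≡ with coprime? η₂ (η₃ ℕ.* η₄)
  ... | no η₂̸⊥η₃η₄ = ⊥-elim (η₂̸⊥η₃η₄ η₂⊥η₃η₄)
  ... | yes _ = cong₂ _*_ (prodℚ-primesOf η₂ M f₁ 1≤η₂ η₂≤M)
    (trans (∏.fold-filter (λ p → ¬? (p ℕ.≟ 2)) (λ p → invℚ (f₂ p)) (primesOf (gcd η₁ η₂)))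
           (prodℚ-primesOf (gcd η₁ η₂) M _ (1≤gcd η₁ η₂ 1≤η₁) (ℕP.≤-trans (∣⇒≤ (gcd[m,n]∣m η₁ η₂)) η₁≤M)))

  d₁ d₂ d₃ d₄ : ℕ → Bool
  d₁ q = does (q ∣? η₁)
  d₂ q = does (q ∣? η₂)
  d₃ q = does (q ∣? η₃)
  d₄ q = does (q ∣? η₄)

  weight-local : ∀ q → q ≤ M →
    onPrimeDivisors M a q * onPrimeDivisors η₁ (λ q → 1ℚ - h₂ q) q ≡
    (if does (prime? q) then weightFactor (d₁ q) (d₂ q) (d₃ q) (d₄ q) (frac 1 q) else 1ℚ)
  weight-local q q≤M with prime? q
  ... | no _   = refl
  ... | yes pq rewrite ∣?-* q η₁ η₂ pq | coprimePart-prime (η₂ ℕ.* η₃) g q pq | ∣?-* q η₂ η₃ pq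
                     | primeProduct-prime M q a⁻¹ pq q≤M | a-prime q pq = refl

  ψν-local : ∀ q →
    (onPrimeDivisors (gcd η₁ (η₃ ℕ.* η₄)) f₁ q * onPrimeDivisors η₁ ψFactor q) *
    (onPrimeDivisors η₂ f₁ q * onPrimeDivisors (gcd η₁ η₂) ν̃Factor q) ≡
    (if does (prime? q) then ψνFactor (d₁ q) (d₂ q) (d₃ q) (d₄ q) (q ℕ.≡ᵇ 2) (frac 1 q) (frac 2 q) else 1ℚ)
  ψν-local q with prime? q
  ... | no _   = refl
  ... | yes pq rewrite ∣?-gcd q η₁ (η₃ ℕ.* η₄) | ∣?-gcd q η₁ η₂ | ∣?-* q η₃ η₄ pq = refl

  d₂∧[d₃∨d₄]≡false : ∀ q → Prime q → d₂ q ∧ (d₃ q ∨ d₄ q) ≡ false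
  d₂∧[d₃∨d₄]≡false q pq with q ∣? η₂ | q ∣? η₃ | q ∣? η₄
  ... | no _     | _       | _       = refl
  ... | yes _    | no _    | no _    = refl
  ... | yes q∣η₂ | yes q∣η₃ | _      = ⊥-elim (prime⇒≢1 pq (η₂⊥η₃η₄ (q∣η₂ , ∣m⇒∣m*n η₄ q∣η₃)))
  ... | yes q∣η₂ | no _    | yes q∣η₄ = ⊥-elim (prime⇒≢1 pq (η₂⊥η₃η₄ (q∣η₂ , ∣n⇒∣m*n η₃ q∣η₄)))

  d₃∧d₄≡false : ∀ q → Prime q → d₃ q ∧ d₄ q ≡ false
  d₃∧d₄≡false q pq with q ∣? η₃ | q ∣? η₄
  ... | no _     | _        = refl
  ... | yes _    | no _     = refl
  ... | yes q∣η₃ | yes q∣η₄ = ⊥-elim (prime⇒≢1 pq (η₃⊥η₄ (q∣η₃ , q∣η₄)))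

  -- (η₁, η₃, η₄) ∈ 𝒩₁ and η₂ odd: exactly the case where ν vanishes but ν̃ need not.
  Exceptional : Set
  Exceptional = 2 ∣ η₁ × ¬ 2 ∣ η₂ × ¬ 2 ∣ η₃ × ¬ 2 ∣ η₄

  exceptional? : Dec Exceptional
  exceptional? = 2 ∣? η₁ ×-dec ¬? (2 ∣? η₂) ×-dec ¬? (2 ∣? η₃) ×-dec ¬? (2 ∣? η₄)

  odd-η₃η₄ : Exceptional → ¬ 2 ∣ η₃ ℕ.* η₄
  odd-η₃η₄ (_ , _ , 2∤η₃ , 2∤η₄) 2∣η₃η₄ with euclidsLemma η₃ η₄ prime[2] 2∣η₃η₄
  ... | inj₁ 2∣η₃ = 2∤η₃ 2∣η₃
  ... | inj₂ 2∣η₄ = 2∤η₄ 2∣η₄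

  at-2 : ¬ Exceptional → ∀ q → (q ℕ.≡ᵇ 2) ∧ (d₁ q ∧ (not (d₂ q) ∧ not (d₃ q ∨ d₄ q))) ≡ false
  at-2 ¬exc zero                = refl
  at-2 ¬exc (suc zero)          = refl
  at-2 ¬exc (suc (suc (suc _))) = refl
  at-2 ¬exc 2 = by-cases (2 ∣? η₁) (2 ∣? η₂) (2 ∣? η₃) (2 ∣? η₄)
    where
    by-cases : (2∣η₁? : Dec (2 ∣ η₁)) (2∣η₂? : Dec (2 ∣ η₂)) (2∣η₃? : Dec (2 ∣ η₃)) (2∣η₄? : Dec (2 ∣ η₄)) →
      does 2∣η₁? ∧ (not (does 2∣η₂?) ∧ not (does 2∣η₃? ∨ does 2∣η₄?)) ≡ false
    by-cases (no _)     _          _          _          = refl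
    by-cases (yes _)    (yes _)    _          _          = refl
    by-cases (yes _)    (no _)     (yes _)    _          = refl
    by-cases (yes _)    (no _)     (no _)     (yes _)    = refl
    by-cases (yes 2∣η₁) (no 2∤η₂)  (no 2∤η₃)  (no 2∤η₄)  = ⊥-elim (¬exc (2∣η₁ , 2∤η₂ , 2∤η₃ , 2∤η₄))

  local-factors : ¬ Exceptional → ∀ q → q ≤ M →
    onPrimeDivisors M a q * onPrimeDivisors η₁ (λ q → 1ℚ - h₂ q) q ≡
    (onPrimeDivisors (gcd η₁ (η₃ ℕ.* η₄)) f₁ q * onPrimeDivisors η₁ ψFactor q) *
    (onPrimeDivisors η₂ f₁ q * onPrimeDivisors (gcd η₁ η₂) ν̃Factor q)
  local-factors ¬exc q q≤M = trans (weight-local q q≤M) (trans at-prime (sym (ψν-local q)))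
    where
    2≢q : (q ℕ.≡ᵇ 2) ≡ false → 2 ≢ q
    2≢q () refl
    at-prime : (if does (prime? q) then weightFactor (d₁ q) (d₂ q) (d₃ q) (d₄ q) (frac 1 q) else 1ℚ) ≡
               (if does (prime? q) then ψνFactor (d₁ q) (d₂ q) (d₃ q) (d₄ q) (q ℕ.≡ᵇ 2) (frac 1 q) (frac 2 q) else 1ℚ)
    at-prime with prime? q
    ... | no _   = refl
    ... | yes pq = weightFactor≡ψνFactor (d₁ q) (d₂ q) (d₃ q) (d₄ q) (q ℕ.≡ᵇ 2) (frac 1 q) (frac 2 q)
      (d₂∧[d₃∨d₄]≡false q pq) (d₃∧d₄≡false q pq) (at-2 ¬exc q) (frac-2 q)
      (*-invℚ _ (1-frac≢0 1 q (prime⇒1≤ pq) (prime⇒≢1 pq ∘ sym)))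
      (λ q≢2 → *-invℚ _ (1-frac≢0 2 q (prime⇒1≤ pq) (2≢q q≢2)))

  innerWeight-generic : ¬ Exceptional → innerWeight η₁ η₂ η₃ η₄ ≡ ψ η₁ η₃ η₄ * νtilde η₁ η₃ η₄ η₂
  innerWeight-generic ¬exc = begin
    innerWeight η₁ η₂ η₃ η₄
      ≡⟨ innerWeight≡ ⟩
    primeProduct M M a * primeProduct M η₁ (λ q → 1ℚ - h₂ q)
      ≡⟨ ∏.big-∙ M _ _ ⟨
    ∏.big M (λ q → onPrimeDivisors M a q * onPrimeDivisors η₁ (λ q → 1ℚ - h₂ q) q)
      ≡⟨ ∏.big-cong M (λ q _ q≤M → local-factors ¬exc q q≤M) ⟩
    ∏.big M (λ q → (Z₁ q * Z₂ q) * (Z₃ q * Z₄ q))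
      ≡⟨ trans (∏.big-∙ M _ _) (cong₂ _*_ (∏.big-∙ M Z₁ Z₂) (∏.big-∙ M Z₃ Z₄)) ⟩
    (∏.big M Z₁ * ∏.big M Z₂) * (∏.big M Z₃ * ∏.big M Z₄)
      ≡⟨ cong₂ _*_ ψ≡ ν̃≡ ⟨
    ψ η₁ η₃ η₄ * νtilde η₁ η₃ η₄ η₂ ∎
    where
    open ≡-Reasoning
    Z₁ Z₂ Z₃ Z₄ : ℕ → ℚ
    Z₁ = onPrimeDivisors (gcd η₁ (η₃ ℕ.* η₄)) f₁
    Z₂ = onPrimeDivisors η₁ ψFactor
    Z₃ = onPrimeDivisors η₂ f₁
    Z₄ = onPrimeDivisors (gcd η₁ η₂) ν̃Factor

  innerWeight-exceptional : Exceptional → innerWeight η₁ η₂ η₃ η₄ ≡ 0ℚ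
  innerWeight-exceptional exc@(2∣η₁ , 2∤η₂ , 2∤η₃ , 2∤η₄) =
    trans innerWeight≡ (trans (sym (∏.big-∙ M _ _)) (∏-zero M 2 _ (s≤s z≤n) 2≤M at-2-vanishes))
    where
    2≤M : 2 ≤ M
    2≤M = ℕP.≤-trans (∣⇒≤ 2∣η₁) η₁≤M
    at-2-vanishes : onPrimeDivisors M a 2 * onPrimeDivisors η₁ (λ q → 1ℚ - h₂ q) 2 ≡ 0ℚ
    at-2-vanishes
      rewrite weight-local 2 2≤M | dec-true (2 ∣? η₁) 2∣η₁ | dec-false (2 ∣? η₂) 2∤η₂
            | dec-false (2 ∣? η₃) 2∤η₃ | dec-false (2 ∣? η₄) 2∤η₄ = refl

  indexN≡1 : Exceptional → indexN η₁ η₃ η₄ ≡ 1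
  indexN≡1 exc@(2∣η₁ , _) with 2 ∣? η₁ | 2 ∣? (η₃ ℕ.* η₄)
  ... | no 2∤η₁ | _          = ⊥-elim (2∤η₁ 2∣η₁)
  ... | yes _   | yes 2∣η₃η₄ = ⊥-elim (odd-η₃η₄ exc 2∣η₃η₄)
  ... | yes _   | no _       = refl

  ν-exceptional : Exceptional → ν η₁ η₃ η₄ η₂ ≡ 0ℚ
  ν-exceptional exc@(_ , 2∤η₂ , _) with 2 ℕ.^ indexN η₁ η₃ η₄ ∣? η₂
  ... | no _      = refl
  ... | yes 2ⁱ∣η₂ = ⊥-elim (2∤η₂ (subst (_∣ η₂) (cong (2 ℕ.^_) (indexN≡1 exc)) 2ⁱ∣η₂))

  ν-generic : ¬ Exceptional → ν η₁ η₃ η₄ η₂ ≡ νtilde η₁ η₃ η₄ η₂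
  ν-generic ¬exc with 2 ℕ.^ indexN η₁ η₃ η₄ ∣? η₂
  ... | yes _   = refl
  ... | no 2ⁱ∤η₂ = ⊥-elim (2ⁱ∤η₂ 2ⁱ∣η₂)
    where
    2ⁱ∣η₂ : 2 ℕ.^ indexN η₁ η₃ η₄ ∣ η₂
    2ⁱ∣η₂ with 2 ∣? η₁ | 2 ∣? (η₃ ℕ.* η₄)
    ... | no _    | _       = 1∣ η₂
    ... | yes _   | yes _   = 1∣ η₂
    ... | yes 2∣η₁ | no 2∤η₃η₄ with 2 ∣? η₂
    ...   | yes 2∣η₂ = 2∣η₂
    ...   | no 2∤η₂  = ⊥-elim (¬exc (2∣η₁ , 2∤η₂ , 2∤η₃η₄ ∘ ∣m⇒∣m*n η₄ , 2∤η₃η₄ ∘ ∣n⇒∣m*n η₃))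

  innerWeight≡ψν : innerWeight η₁ η₂ η₃ η₄ ≡ ψ η₁ η₃ η₄ * ν η₁ η₃ η₄ η₂
  innerWeight≡ψν with exceptional?
  ... | yes exc  = trans (innerWeight-exceptional exc)
                         (sym (trans (cong (ψ η₁ η₃ η₄ *_) (ν-exceptional exc)) (ℚP.*-zeroʳ (ψ η₁ η₃ η₄))))
  ... | no ¬exc = trans (innerWeight-generic ¬exc) (cong (ψ η₁ η₃ η₄ *_) (sym (ν-generic ¬exc)))

ν-noncoprime : ∀ η₁ η₃ η₄ η₂ → ¬ Coprime η₂ (η₃ ℕ.* η₄) → ν η₁ η₃ η₄ η₂ ≡ 0ℚ
ν-noncoprime η₁ η₃ η₄ η₂ η₂̸⊥η₃η₄ with 2 ℕ.^ indexN η₁ η₃ η₄ ∣? η₂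
... | no _ = refl
... | yes _ with coprime? η₂ (η₃ ℕ.* η₄)
...   | yes η₂⊥η₃η₄ = ⊥-elim (η₂̸⊥η₃η₄ η₂⊥η₃η₄)
...   | no _        = refl

∈-range1⇒1≤ : ∀ {x N} → x ∈ range1 N → 1 ≤ x
∈-range1⇒1≤ x∈ with ∈P.∈-map⁻ suc x∈
... | _ , _ , refl = s≤s z≤n

module _ {c ℓ : Level} (R : CommutativeRing c ℓ) where
  open CommutativeRing R using (Carrier; _≈_; 0#; +-cong; +-congˡ; +-identityˡ; zeroʳ; distribˡ)
    renaming (_*_ to _·_; refl to ≈-refl; sym to ≈-sym; trans to ≈-trans)

  sumR-filter : ∀ {B : Set} {P : Pred B 0ℓ} (P? : Decidable P) (F : B → Carrier) xs →
    sumR R (map F (filter P? xs)) ≈ sumR R (map (λ x → if does (P? x) then F x else 0#) xs)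
  sumR-filter P? F []       = ≈-refl
  sumR-filter P? F (x ∷ xs) with does (P? x)
  ... | true  = +-congˡ (sumR-filter P? F xs)
  ... | false = ≈-trans (sumR-filter P? F xs) (≈-sym (+-identityˡ _))

  ·-sumR : ∀ k (F : ℕ → Carrier) xs → k · sumR R (map F xs) ≈ sumR R (map (λ x → k · F x) xs)
  ·-sumR k F []       = zeroʳ k
  ·-sumR k F (x ∷ xs) = ≈-trans (distribˡ k (F x) _) (+-congˡ (·-sumR k F xs))

  sumR-cong : ∀ {F G : ℕ → Carrier} xs → (∀ {x} → x ∈ xs → F x ≈ G x) → sumR R (map F xs) ≈ sumR R (map G xs)
  sumR-cong []       F≈G = ≈-refl
  sumR-cong (x ∷ xs) F≈G = +-cong (F≈G (Any.here refl)) (sumR-cong xs (F≈G ∘ Any.there))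

lemma3p6 : {c ℓ : Level} (R : CommutativeRing c ℓ) (ι : ℚ → CommutativeRing.Carrier R) →
    IsℚAlgebraMap R ι →
    (η₁ η₃ η₄ : ℕ) → 1 ≤ η₁ → 1 ≤ η₃ → 1 ≤ η₄ → Coprime η₃ η₄ →
    (N : ℕ) (w : ℕ → CommutativeRing.Carrier R) →
    CommutativeRing._≈_ R (T₂ R ι η₁ η₃ η₄ N w) (T₂rhs R ι η₁ η₃ η₄ N w)
lemma3p6 R ι ι-hom η₁ η₃ η₄ 1≤η₁ _ _ η₃⊥η₄ N w = begin
  T₂ R ι η₁ η₃ η₄ N w
    ≈⟨ sumR-filter R (λ η₂ → coprime? η₂ (η₃ ℕ.* η₄)) summand (range1 N) ⟩
  sumR R (map (λ η₂ → if does (coprime? η₂ (η₃ ℕ.* η₄)) then summand η₂ else 0#) (range1 N))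
    ≈⟨ sumR-cong R (range1 N) (λ η₂∈ → term _ (∈-range1⇒1≤ η₂∈) (coprime? _ _)) ⟩
  sumR R (map (λ η₂ → ι (ψ η₁ η₃ η₄) · (ι (ν η₁ η₃ η₄ η₂) · w η₂)) (range1 N))
    ≈⟨ ·-sumR R (ι (ψ η₁ η₃ η₄)) _ (range1 N) ⟨
  T₂rhs R ι η₁ η₃ η₄ N w ∎
  where
  open CommutativeRing R using (Carrier; _≈_; 0#; *-congˡ; *-congʳ; *-comm; *-assoc; zeroˡ; zeroʳ; reflexive; setoid)
    renaming (_*_ to _·_; trans to ≈-trans)
  open IsRingHomomorphism ι-hom using (*-homo; 0#-homo)
  open SetoidReasoning setoid
  summand : ℕ → Carrier
  summand η₂ = w η₂ · ι (innerWeight η₁ η₂ η₃ η₄)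
  term : ∀ η₂ → 1 ≤ η₂ → (η₂⊥η₃η₄? : Dec (Coprime η₂ (η₃ ℕ.* η₄))) →
    (if does η₂⊥η₃η₄? then summand η₂ else 0#) ≈ ι (ψ η₁ η₃ η₄) · (ι (ν η₁ η₃ η₄ η₂) · w η₂)
  term η₂ 1≤η₂ (yes η₂⊥η₃η₄) = begin
    w η₂ · ι (innerWeight η₁ η₂ η₃ η₄)
      ≈⟨ *-congˡ (reflexive (cong ι (InnerWeight.innerWeight≡ψν η₁ η₂ η₃ η₄ 1≤η₁ 1≤η₂ η₃⊥η₄ η₂⊥η₃η₄))) ⟩
    w η₂ · ι (ψ η₁ η₃ η₄ ℚ.* ν η₁ η₃ η₄ η₂)
      ≈⟨ *-congˡ (*-homo _ _) ⟩
    w η₂ · (ι (ψ η₁ η₃ η₄) · ι (ν η₁ η₃ η₄ η₂))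
      ≈⟨ *-comm _ _ ⟩
    (ι (ψ η₁ η₃ η₄) · ι (ν η₁ η₃ η₄ η₂)) · w η₂
      ≈⟨ *-assoc _ _ _ ⟩
    ι (ψ η₁ η₃ η₄) · (ι (ν η₁ η₃ η₄ η₂) · w η₂) ∎
  term η₂ _ (no η₂̸⊥η₃η₄) = begin
    0#                                          ≈⟨ zeroʳ _ ⟨
    ι (ψ η₁ η₃ η₄) · 0#                         ≈⟨ *-congˡ (zeroˡ (w η₂)) ⟨
    ι (ψ η₁ η₃ η₄) · (0# · w η₂)                ≈⟨ *-congˡ (*-congʳ ι[ν]≈0) ⟨
    ι (ψ η₁ η₃ η₄) · (ι (ν η₁ η₃ η₄ η₂) · w η₂) ∎
    where
    ι[ν]≈0 : ι (ν η₁ η₃ η₄ η₂) ≈ 0#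
    ι[ν]≈0 = ≈-trans (reflexive (cong ι (ν-noncoprime η₁ η₃ η₄ η₂ η₂̸⊥η₃η₄))) 0#-homo
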